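{- Let $p$ be a prime. For every integer $n\ge1$, $$\int_{\mathbb{Z}_p}x\cdot x^{(n)}\,d\mu_1(x)=\sum_{k=1}^{n}(-1)^{k+1}\binom{n-1}{k-1}\frac{n!}{k^2+3k+2}.$$
   Context: The Volkenborn integral of a polynomial function $f:\mathbb{Z}_p\to\mathbb{Q}_p$ is $\int_{\mathbb{Z}_p}f(x)\,d\mu_1(x)=\lim_{N\to\infty}p^{ -N}\sum_{x=0}^{p^N-1}f(x)$. The rising factorial is $x^{(n)}=x(x+1)\cdots(x+n-1)$, $x^{(0)}=1$. -}

module Defs where

open import Data.Nat as ℕ using (ℕ; zero; suc; _≤_; NonZero; _!)
open import Data.Nat.Divisibility using (_∣_)
open import Data.Nat.Properties using (m^n≢0)
open import Data.Nat.Primality using (Prime; prime⇒nonZero)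
open import Data.Nat.Combinatorics using (_C_)
open import Data.Integer as ℤ using (ℤ; +_)
open import Data.Rational as ℚ using (ℚ; ↥_; ↧ₙ_; _/_)
open import Data.Product using (∃-syntax)
open import Relation.Nullary using (¬_)

rising : ℕ → ℕ → ℕ
rising x zero    = 1
rising x (suc n) = rising x n ℕ.* (x ℕ.+ n)

sumℕ : ℕ → (ℕ → ℕ) → ℕ
sumℕ zero    f = 0
sumℕ (suc m) f = sumℕ m f ℕ.+ f m

sumℚ1 : ℕ → (ℕ → ℚ) → ℚ
sumℚ1 zero    g = ℚ.0ℚ
sumℚ1 (suc n) g = sumℚ1 n g ℚ.+ g (suc n)

-- p-adic valuation of q is at least e (e ≥ 0):  p ∤ denominator, p^e ∣ numerator
-- (q in lowest terms; q = 0 has valuation +∞).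
ValAtLeast : ℕ → ℕ → ℚ → Set
ValAtLeast p e q = (¬ (p ∣ (↧ₙ q))) Data.Product.× ((p ℕ.^ e) ∣ ℤ.∣ ↥ q ∣)

PAdicLimit : ℕ → (ℕ → ℚ) → ℚ → Set
PAdicLimit p a L = ∀ (e : ℕ) → ∃[ N₀ ] (∀ (N : ℕ) → N₀ ≤ N → ValAtLeast p e (a N ℚ.- L))

volkenbornSum : (p : ℕ) → Prime p → (ℕ → ℕ) → ℕ → ℚ
volkenbornSum p pr f N =
  let instance _ = m^n≢0 p N {{prime⇒nonZero pr}}
  in (+ sumℕ (p ℕ.^ N) f) / (p ℕ.^ N)

VolkenbornIntegralEq : (p : ℕ) → Prime p → (ℕ → ℕ) → ℚ → Set
VolkenbornIntegralEq p pr f L = PAdicLimit p (volkenbornSum p pr f) L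

rhsTerm : ℕ → ℕ → ℚ
rhsTerm n k = (ℤ.-1ℤ ℤ.^ (k ℕ.+ 1) ℤ.* (+ (((n ℕ.∸ 1) C (k ℕ.∸ 1)) ℕ.* (n !)))) / (2 ℕ.+ (3 ℕ.* k ℕ.+ k ℕ.* k))

rhs : ℕ → ℚ
rhs n = sumℚ1 n (rhsTerm n)

{-# OPTIONS --safe #-}
module Submission where

-- Write x^(k) for the rising factorial. Since x·x^(n) = x^(n+1) - n·x^(n) and
-- Σ_{x<M} x^(k+1) = (M-1)^(k+2)/(k+2) with (M-1)^(k+2) = (M-1)·M·(M+1)^(k) and (M+1)^(k) ≡ k! (mod M),
-- one finds (n+1)(n+2)·Σ_{x<M} x·x^(n) ≡ M·n! (mod M²). Hence the Riemann sum at M = p^N equals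
-- n!/((n+1)(n+2)) + p^N·w/((n+1)(n+2)) with w an integer, which tends p-adically to n!/((n+1)(n+2)).
-- The right-hand side has the same value: C(n-1,k-1)/((k+1)(k+2)) = k·C(n+2,k+2)/(n(n+1)(n+2)), and
-- Σ_k (-1)^(k+1) k·C(n+2,k+2) = n because alternating binomial sums annihilate affine functions.

open import Defs
open import Function using (_∘_; const)
open import Data.Nat as ℕ using (ℕ; zero; suc; _+_; _*_; _^_; _!; _<_; _≤_; _∸_; NonZero; z≤n; s≤s)
open import Data.Nat.Properties
  using ( *-comm; *-assoc; +-suc; +-identityʳ; *-identityˡ; *-identityʳ; *-zeroʳ; +-cancelʳ-≡; *-cancelˡ-≡
        ; n<1+n; m<m*n; m*n≢0; m^n≢0; ^-distribˡ-+-*; m+[n∸m]≡n)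
open import Data.Nat.Combinatorics using (_C_; nC1≡n; nCk+nC[k+1]≡[n+1]C[k+1]; k>n⇒nCk≡0)
open import Data.Nat.Divisibility using (_∣_; divides; _∣?_; ∣-trans; m∣m*n; 1∣_; *-cancelˡ-∣; *-monoʳ-∣)
open import Data.Nat.Primality using (Prime; euclidsLemma; prime⇒nonZero; prime⇒nonTrivial)
open import Data.Nat.Coprimality as Coprime using (coprime-divisor)
open import Data.Nat.Induction using (<-rec)
import Data.Nat.Tactic.RingSolver as ℕ-Solver
open import Data.Integer as ℤ using (ℤ; +_; -1ℤ; 0ℤ)
import Data.Integer.Properties as ℤ
import Data.Integer.Tactic.RingSolver as ℤ-Solver
open import Data.Rational as ℚ using (ℚ; _/_; toℚᵘ; ↥_; ↧_; ↧ₙ_)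
import Data.Rational.Properties as ℚ
open import Data.Rational.Unnormalised as ℚᵘ using (mkℚᵘ; *≡*) renaming (_≃_ to _≃ᵘ_)
import Data.Rational.Unnormalised.Properties as ℚᵘ
open import Data.Product using (∃; ∃₂; _×_; _,_)
open import Data.Sum using (inj₁; inj₂)
open import Relation.Nullary using (¬_; yes; no; contradiction)
open import Relation.Binary.PropositionalEquality
  using (_≡_; refl; sym; trans; cong; cong₂; subst; module ≡-Reasoning)

open ≡-Reasoning

-- Sums of rising factorials

rising-suc : ∀ x k → rising x (suc k) ≡ x * rising (suc x) k
rising-suc x zero    = oneFactor x
  where
  oneFactor : ∀ x → 1 * (x + 0) ≡ x * 1
  oneFactor = ℕ-Solver.solve-∀
rising-suc x (suc k) = begin
  rising x (suc k) * (x + suc k)     ≡⟨ cong₂ _*_ (rising-suc x k) (+-suc x k) ⟩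
  x * rising (suc x) k * (suc x + k) ≡⟨ *-assoc x _ _ ⟩
  x * rising (suc x) (suc k)         ∎

sumℕ-rising : ∀ k m → (2 + k) * sumℕ (suc m) (λ x → rising x (suc k)) ≡ rising m (2 + k)
sumℕ-rising k zero rewrite rising-suc 0 k = *-zeroʳ (2 + k)
sumℕ-rising k (suc m) = begin
  (2 + k) * (sumℕ (suc m) r + rising (suc m) (suc k))
    ≡⟨ distrib (2 + k) (sumℕ (suc m) r) _ ⟩
  (2 + k) * sumℕ (suc m) r + (2 + k) * rising (suc m) (suc k)
    ≡⟨ cong (_+ (2 + k) * rising (suc m) (suc k)) (sumℕ-rising k m) ⟩
  rising m (2 + k) + (2 + k) * rising (suc m) (suc k)
    ≡⟨ cong (_+ (2 + k) * rising (suc m) (suc k)) (rising-suc m (suc k)) ⟩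
  m * rising (suc m) (suc k) + (2 + k) * rising (suc m) (suc k)
    ≡⟨ collect m k (rising (suc m) (suc k)) ⟩
  rising (suc m) (suc k) * (suc m + suc k) ∎
  where
  r = λ x → rising x (suc k)
  distrib : ∀ a b c → a * (b + c) ≡ a * b + a * c
  distrib = ℕ-Solver.solve-∀
  collect : ∀ m k r → m * r + (2 + k) * r ≡ r * (suc m + suc k)
  collect = ℕ-Solver.solve-∀

rising-suc-mod : ∀ m k → ∃ λ q → rising (suc m) k ≡ k ! + m * q
rising-suc-mod m zero    = 0 , cong suc (sym (*-zeroʳ m))
rising-suc-mod m (suc k) with rising-suc-mod m k
... | q , eq = k ! + q * (suc m + k) , (begin
  rising (suc m) k * (suc m + k) ≡⟨ cong (_* (suc m + k)) eq ⟩
  (k ! + m * q) * (suc m + k)     ≡⟨ expand m k (k !) q ⟩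
  suc k ! + m * (k ! + q * (suc m + k)) ∎)
  where
  expand : ∀ m k f q → (f + m * q) * (suc m + k) ≡ (f + k * f) + m * (f + q * (suc m + k))
  expand = ℕ-Solver.solve-∀

sumℕ-x*rising : ∀ k M → sumℕ M (λ x → x * rising x k) + k * sumℕ M (λ x → rising x k)
                      ≡ sumℕ M (λ x → rising x (suc k))
sumℕ-x*rising k zero    = *-zeroʳ k
sumℕ-x*rising k (suc M) = begin
  (a + M * r) + k * (b + r)  ≡⟨ regroup a b M r k ⟩
  (a + k * b) + r * (M + k)  ≡⟨ cong (_+ r * (M + k)) (sumℕ-x*rising k M) ⟩
  sumℕ M (λ x → rising x (suc k)) + r * (M + k) ∎
  where
  r = rising M k
  a = sumℕ M (λ x → x * rising x k)
  b = sumℕ M (λ x → rising x k)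
  regroup : ∀ a b x r k → (a + x * r) + k * (b + r) ≡ (a + k * b) + r * (x + k)
  regroup = ℕ-Solver.solve-∀

-- Both sides are shifted by multiples of m, so that no subtraction occurs.
infix 4 _≈_mod_
_≈_mod_ : ℕ → ℕ → ℕ → Set
a ≈ b mod m = ∃₂ λ x y → a + m * x ≡ b + m * y

≈mod⇒≡+*ℤ : ∀ {a b m} → a ≈ b mod m → ∃ λ w → + a ≡ + b ℤ.+ + m ℤ.* w
≈mod⇒≡+*ℤ {a} {b} {m} (x , y , a+mx≡b+my) = + y ℤ.- + x , (begin
  + a                                       ≡⟨ addSub (+ a) (+ m ℤ.* + x) ⟩
  + a ℤ.+ + m ℤ.* + x ℤ.- + m ℤ.* + x        ≡⟨ cong (ℤ._- + m ℤ.* + x) (lift a+mx≡b+my) ⟩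
  + b ℤ.+ + m ℤ.* + y ℤ.- + m ℤ.* + x        ≡⟨ factor (+ b) (+ m) (+ x) (+ y) ⟩
  + b ℤ.+ + m ℤ.* (+ y ℤ.- + x)             ∎)
  where
  addSub : ∀ a c → a ≡ a ℤ.+ c ℤ.- c
  addSub = ℤ-Solver.solve-∀
  factor : ∀ b m x y → b ℤ.+ m ℤ.* y ℤ.- m ℤ.* x ≡ b ℤ.+ m ℤ.* (y ℤ.- x)
  factor = ℤ-Solver.solve-∀
  pos-+-* : ∀ a m x → + (a + m * x) ≡ + a ℤ.+ + m ℤ.* + x
  pos-+-* a m x = trans (ℤ.pos-+ a (m * x)) (cong (ℤ._+_ (+ a)) (ℤ.pos-* m x))
  lift : a + m * x ≡ b + m * y → + a ℤ.+ + m ℤ.* + x ≡ + b ℤ.+ + m ℤ.* + y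
  lift eq = trans (sym (pos-+-* a m x)) (trans (cong +_ eq) (pos-+-* b m y))

sumℕ-x*rising-mod : ∀ n M →
  (2 + n) * (3 + n) * sumℕ M (λ x → x * rising x (suc n)) ≈ M * suc n ! mod (M * M)
sumℕ-x*rising-mod n zero    = 0 , 0 , cong (_+ 0) (*-zeroʳ ((2 + n) * (3 + n)))
sumℕ-x*rising-mod n (suc m) with rising-suc-mod (suc m) n | rising-suc-mod (suc m) (suc n)
... | q₀ , r₀ | q₁ , r₁ = a , b , +-cancelʳ-≡ _ _ _ (begin
  D * S + M * M * a + E
    ≡⟨ regroupˡ n S A (M * M * a) ⟩
  (2 + n) * ((3 + n) * (S + suc n * A)) + M * M * a
    ≡⟨ cong (λ z → (2 + n) * ((3 + n) * z) + M * M * a) (sumℕ-x*rising (suc n) M) ⟩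
  (2 + n) * ((3 + n) * B) + M * M * a
    ≡⟨ cong (λ z → (2 + n) * z + M * M * a) (expandSum (suc n) q₁ r₁) ⟩
  (2 + n) * (m * (M * (suc n ! + M * q₁))) + M * M * a
    ≡⟨ regroupʳ m n (n !) q₀ q₁ ⟩
  M * suc n ! + M * M * b + (3 + n) * suc n * (m * (M * (n ! + M * q₀)))
    ≡⟨ cong (λ z → M * suc n ! + M * M * b + (3 + n) * suc n * z) (sym (expandSum n q₀ r₀)) ⟩
  M * suc n ! + M * M * b + E
    ∎)
  where
  M = suc m
  D = (2 + n) * (3 + n)
  S = sumℕ M (λ x → x * rising x (suc n))
  A = sumℕ M (λ x → rising x (suc n))
  B = sumℕ M (λ x → rising x (suc (suc n)))
  -- E is added to both sides so that D·S = (2+n)(3+n)·B − (n+1)(3+n)·(2+n)·A needs no subtraction.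
  E = (3 + n) * suc n * ((2 + n) * A)
  a = suc n ! + m * (suc n * (3 + n)) * q₀
  b = m * (2 + n) * q₁
  expandSum : ∀ k q → rising (suc M) k ≡ k ! + M * q →
              (2 + k) * sumℕ M (λ x → rising x (suc k)) ≡ m * (M * (k ! + M * q))
  expandSum k q r = begin
    (2 + k) * sumℕ M (λ x → rising x (suc k)) ≡⟨ sumℕ-rising k m ⟩
    rising m (2 + k)                          ≡⟨ rising-suc m (suc k) ⟩
    m * rising M (suc k)                      ≡⟨ cong (m *_) (rising-suc M k) ⟩
    m * (M * rising (suc M) k)                ≡⟨ cong (λ z → m * (M * z)) r ⟩
    m * (M * (k ! + M * q))                   ∎
  regroupˡ : ∀ n S A c → (2 + n) * (3 + n) * S + c + (3 + n) * suc n * ((2 + n) * A)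
                       ≡ (2 + n) * ((3 + n) * (S + suc n * A)) + c
  regroupˡ = ℕ-Solver.solve-∀
  regroupʳ : ∀ m n f q₀ q₁ →
    (2 + n) * (m * (suc m * ((f + n * f) + suc m * q₁))) + suc m * suc m * ((f + n * f) + m * (suc n * (3 + n)) * q₀)
    ≡ suc m * (f + n * f) + suc m * suc m * (m * (2 + n) * q₁) + (3 + n) * suc n * (m * (suc m * (f + suc m * q₀)))
  regroupʳ = ℕ-Solver.solve-∀

-- Binomial coefficients and alternating sums

[k+1]*[n+1]C[k+1]≡[n+1]*nCk : ∀ n k → suc k * (suc n C suc k) ≡ suc n * (n C k)
[k+1]*[n+1]C[k+1]≡[n+1]*nCk zero zero = refl
[k+1]*[n+1]C[k+1]≡[n+1]*nCk zero (suc k)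
  rewrite k>n⇒nCk≡0 {1} {suc (suc k)} (s≤s (s≤s z≤n)) | k>n⇒nCk≡0 {0} {suc k} (s≤s z≤n)
  = *-zeroʳ (suc (suc k))
[k+1]*[n+1]C[k+1]≡[n+1]*nCk (suc n) zero =
  trans (*-identityˡ _) (trans (nC1≡n (suc (suc n))) (sym (*-identityʳ _)))
[k+1]*[n+1]C[k+1]≡[n+1]*nCk (suc n) (suc k) = begin
  suc (suc k) * (suc (suc n) C suc (suc k))
    ≡⟨ cong (suc (suc k) *_) (sym (nCk+nC[k+1]≡[n+1]C[k+1] (suc n) (suc k))) ⟩
  suc (suc k) * (a + b)
    ≡⟨ split k a b ⟩
  a + suc k * a + suc (suc k) * b
    ≡⟨ cong₂ (λ x y → a + x + y) ([k+1]*[n+1]C[k+1]≡[n+1]*nCk n k) ([k+1]*[n+1]C[k+1]≡[n+1]*nCk n (suc k)) ⟩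
  a + suc n * (n C k) + suc n * (n C suc k)
    ≡⟨ merge n a (n C k) (n C suc k) ⟩
  a + suc n * (n C k + n C suc k)
    ≡⟨ cong (λ z → a + suc n * z) (nCk+nC[k+1]≡[n+1]C[k+1] n k) ⟩
  a + suc n * a ∎
  where
  a = suc n C suc k
  b = suc n C suc (suc k)
  split : ∀ k a b → suc (suc k) * (a + b) ≡ a + suc k * a + suc (suc k) * b
  split = ℕ-Solver.solve-∀
  merge : ∀ n a x y → a + suc n * x + suc n * y ≡ a + suc n * (x + y)
  merge = ℕ-Solver.solve-∀

[k+1][k+2][k+3]*[n+3]C[k+3]≡[n+1][n+2][n+3]*nCk : ∀ n k →
  suc k * (2 + k) * (3 + k) * ((3 + n) C (3 + k)) ≡ suc n * (2 + n) * (3 + n) * (n C k)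
[k+1][k+2][k+3]*[n+3]C[k+3]≡[n+1][n+2][n+3]*nCk n k = begin
  suc k * (2 + k) * (3 + k) * ((3 + n) C (3 + k))
    ≡⟨ reassoc (suc k) (2 + k) (3 + k) ((3 + n) C (3 + k)) ⟩
  suc k * ((2 + k) * ((3 + k) * ((3 + n) C (3 + k))))
    ≡⟨ cong (λ z → suc k * ((2 + k) * z)) ([k+1]*[n+1]C[k+1]≡[n+1]*nCk (2 + n) (2 + k)) ⟩
  suc k * ((2 + k) * ((3 + n) * ((2 + n) C (2 + k))))
    ≡⟨ pull (suc k) (2 + k) (3 + n) ((2 + n) C (2 + k)) ⟩
  (3 + n) * (suc k * ((2 + k) * ((2 + n) C (2 + k))))
    ≡⟨ cong (λ z → (3 + n) * (suc k * z)) ([k+1]*[n+1]C[k+1]≡[n+1]*nCk (suc n) (suc k)) ⟩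
  (3 + n) * (suc k * ((2 + n) * (suc n C suc k)))
    ≡⟨ cong ((3 + n) *_) (pull₁ (suc k) (2 + n) (suc n C suc k)) ⟩
  (3 + n) * ((2 + n) * (suc k * (suc n C suc k)))
    ≡⟨ cong (λ z → (3 + n) * ((2 + n) * z)) ([k+1]*[n+1]C[k+1]≡[n+1]*nCk n k) ⟩
  (3 + n) * ((2 + n) * (suc n * (n C k)))
    ≡⟨ reorder (3 + n) (2 + n) (suc n) (n C k) ⟩
  suc n * (2 + n) * (3 + n) * (n C k) ∎
  where
  reassoc : ∀ a b c x → a * b * c * x ≡ a * (b * (c * x))
  reassoc = ℕ-Solver.solve-∀
  pull : ∀ a b c x → a * (b * (c * x)) ≡ c * (a * (b * x))
  pull = ℕ-Solver.solve-∀
  pull₁ : ∀ a b x → a * (b * x) ≡ b * (a * x)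
  pull₁ = ℕ-Solver.solve-∀
  reorder : ∀ a b c x → a * (b * (c * x)) ≡ c * b * a * x
  reorder = ℕ-Solver.solve-∀

sumℤ : ℕ → (ℕ → ℤ) → ℤ
sumℤ zero    f = 0ℤ
sumℤ (suc m) f = sumℤ m f ℤ.+ f m

sumℤ-cong : ∀ m {f g} → (∀ k → f k ≡ g k) → sumℤ m f ≡ sumℤ m g
sumℤ-cong zero    f≡g = refl
sumℤ-cong (suc m) f≡g = cong₂ ℤ._+_ (sumℤ-cong m f≡g) (f≡g m)

sumℤ-distrib-+ : ∀ m f g → sumℤ m (λ k → f k ℤ.+ g k) ≡ sumℤ m f ℤ.+ sumℤ m g
sumℤ-distrib-+ zero    f g = refl
sumℤ-distrib-+ (suc m) f g =
  trans (cong (ℤ._+ (f m ℤ.+ g m)) (sumℤ-distrib-+ m f g)) (interchange (sumℤ m f) (sumℤ m g) (f m) (g m))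
  where
  interchange : ∀ a b c d → a ℤ.+ b ℤ.+ (c ℤ.+ d) ≡ a ℤ.+ c ℤ.+ (b ℤ.+ d)
  interchange = ℤ-Solver.solve-∀

*-distribˡ-sumℤ : ∀ m c f → sumℤ m (λ k → c ℤ.* f k) ≡ c ℤ.* sumℤ m f
*-distribˡ-sumℤ zero    c f = sym (ℤ.*-zeroʳ c)
*-distribˡ-sumℤ (suc m) c f =
  trans (cong (ℤ._+ (c ℤ.* f m)) (*-distribˡ-sumℤ m c f)) (sym (ℤ.*-distribˡ-+ c _ _))

sumℤ-suc-shift : ∀ m f → sumℤ (suc m) f ≡ f 0 ℤ.+ sumℤ m (f ∘ suc)
sumℤ-suc-shift zero    f = trans (ℤ.+-identityˡ (f 0)) (sym (ℤ.+-identityʳ (f 0)))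
sumℤ-suc-shift (suc m) f = trans (cong (ℤ._+ f (suc m)) (sumℤ-suc-shift m f)) (ℤ.+-assoc (f 0) _ _)

-- (-1)^N times the N-th forward difference of g at 0.
alternatingBinomialSum : ℕ → (ℕ → ℤ) → ℤ
alternatingBinomialSum N g = sumℤ (suc N) (λ k → -1ℤ ℤ.^ k ℤ.* (+ (N C k) ℤ.* g k))

alternatingBinomialSum-cong : ∀ N {f g} → (∀ k → f k ≡ g k) →
                              alternatingBinomialSum N f ≡ alternatingBinomialSum N g
alternatingBinomialSum-cong N f≡g =
  sumℤ-cong (suc N) (λ k → cong (λ z → -1ℤ ℤ.^ k ℤ.* (+ (N C k) ℤ.* z)) (f≡g k))

alternatingBinomialSum-distrib-+ : ∀ N f g → alternatingBinomialSum N (λ k → f k ℤ.+ g k)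
                                           ≡ alternatingBinomialSum N f ℤ.+ alternatingBinomialSum N g
alternatingBinomialSum-distrib-+ N f g =
  trans (sumℤ-cong (suc N) (λ k → distrib (-1ℤ ℤ.^ k) (+ (N C k)) (f k) (g k))) (sumℤ-distrib-+ (suc N) _ _)
  where
  distrib : ∀ s c x y → s ℤ.* (c ℤ.* (x ℤ.+ y)) ≡ s ℤ.* (c ℤ.* x) ℤ.+ s ℤ.* (c ℤ.* y)
  distrib = ℤ-Solver.solve-∀

alternatingBinomialSum-suc : ∀ N g → alternatingBinomialSum (suc N) g
                                   ≡ alternatingBinomialSum N g ℤ.- alternatingBinomialSum N (g ∘ suc)
alternatingBinomialSum-suc N g = begin
  sumℤ (suc (suc N)) t
    ≡⟨ sumℤ-suc-shift (suc N) t ⟩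
  u 0 ℤ.+ sumℤ (suc N) (t ∘ suc)
    ≡⟨ cong (ℤ._+_ (u 0)) (trans (sumℤ-cong (suc N) pascal) (sumℤ-distrib-+ (suc N) _ _)) ⟩
  u 0 ℤ.+ (sumℤ (suc N) (λ k → -1ℤ ℤ.* v k) ℤ.+ sumℤ (suc N) (u ∘ suc))
      ≡⟨ cong₂ (λ x y → u 0 ℤ.+ (x ℤ.+ y)) (*-distribˡ-sumℤ (suc N) -1ℤ v) tail ⟩
  u 0 ℤ.+ (-1ℤ ℤ.* A′ ℤ.+ (A ℤ.- u 0))                        ≡⟨ rearrange (u 0) A A′ ⟩
  A ℤ.- A′                                                      ∎
  where
  A  = alternatingBinomialSum N g
  A′ = alternatingBinomialSum N (g ∘ suc)
  t u v : ℕ → ℤ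
  t k = -1ℤ ℤ.^ k ℤ.* (+ (suc N C k) ℤ.* g k)
  u k = -1ℤ ℤ.^ k ℤ.* (+ (N C k) ℤ.* g k)
  v k = -1ℤ ℤ.^ k ℤ.* (+ (N C k) ℤ.* g (suc k))
  split : ∀ s a b x → (-1ℤ ℤ.* s) ℤ.* ((a ℤ.+ b) ℤ.* x) ≡ -1ℤ ℤ.* (s ℤ.* (a ℤ.* x)) ℤ.+ (-1ℤ ℤ.* s) ℤ.* (b ℤ.* x)
  split = ℤ-Solver.solve-∀
  pascal : ∀ k → t (suc k) ≡ -1ℤ ℤ.* v k ℤ.+ u (suc k)
  pascal k = trans (cong (λ c → -1ℤ ℤ.^ suc k ℤ.* (c ℤ.* g (suc k)))
                         (trans (cong +_ (sym (nCk+nC[k+1]≡[n+1]C[k+1] N k))) (ℤ.pos-+ (N C k) (N C suc k))))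
                   (split (-1ℤ ℤ.^ k) (+ (N C k)) (+ (N C suc k)) (g (suc k)))
  u[1+N]≡0 : u (suc N) ≡ 0ℤ
  u[1+N]≡0 rewrite k>n⇒nCk≡0 (n<1+n N) = ℤ.*-zeroʳ (-1ℤ ℤ.^ suc N)
  cancel : ∀ a b → a ℤ.+ b ℤ.- a ≡ b
  cancel = ℤ-Solver.solve-∀
  tail : sumℤ (suc N) (u ∘ suc) ≡ A ℤ.- u 0
  tail = begin
    sumℤ (suc N) (u ∘ suc)                     ≡⟨ sym (cancel (u 0) _) ⟩
    u 0 ℤ.+ sumℤ (suc N) (u ∘ suc) ℤ.- u 0      ≡⟨ cong (ℤ._- u 0) (sym (sumℤ-suc-shift (suc N) u)) ⟩
    A ℤ.+ u (suc N) ℤ.- u 0                     ≡⟨ cong (λ z → A ℤ.+ z ℤ.- u 0) u[1+N]≡0 ⟩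
    A ℤ.+ 0ℤ ℤ.- u 0                            ≡⟨ cong (ℤ._- u 0) (ℤ.+-identityʳ A) ⟩
    A ℤ.- u 0                                   ∎
  rearrange : ∀ a b c → a ℤ.+ (-1ℤ ℤ.* c ℤ.+ (b ℤ.- a)) ≡ b ℤ.- c
  rearrange = ℤ-Solver.solve-∀

alternatingBinomialSum-const : ∀ N c → alternatingBinomialSum (suc N) (const c) ≡ 0ℤ
alternatingBinomialSum-const N c =
  trans (alternatingBinomialSum-suc N (const c)) (ℤ.+-inverseʳ (alternatingBinomialSum N (const c)))

alternatingBinomialSum-id : ∀ N → alternatingBinomialSum (suc (suc N)) (+_) ≡ 0ℤ
alternatingBinomialSum-id N = begin
  A (suc (suc N)) (+_)
    ≡⟨ alternatingBinomialSum-suc (suc N) (+_) ⟩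
  A (suc N) (+_) ℤ.- A (suc N) (λ k → + suc k)
    ≡⟨ cong (ℤ._-_ (A (suc N) (+_))) shift ⟩
  A (suc N) (+_) ℤ.- (A (suc N) (const (+ 1)) ℤ.+ A (suc N) (+_))
    ≡⟨ cong (λ z → A (suc N) (+_) ℤ.- (z ℤ.+ A (suc N) (+_))) (alternatingBinomialSum-const N (+ 1)) ⟩
  A (suc N) (+_) ℤ.- (0ℤ ℤ.+ A (suc N) (+_))
    ≡⟨ vanish (A (suc N) (+_)) ⟩
  0ℤ ∎
  where
  A = alternatingBinomialSum
  shift : A (suc N) (λ k → + suc k) ≡ A (suc N) (const (+ 1)) ℤ.+ A (suc N) (+_)
  shift = trans (alternatingBinomialSum-cong (suc N) (ℤ.pos-+ 1)) (alternatingBinomialSum-distrib-+ (suc N) _ _)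
  vanish : ∀ a → a ℤ.- (0ℤ ℤ.+ a) ≡ 0ℤ
  vanish = ℤ-Solver.solve-∀

-- The terms k = 0, 1, 2 of the vanishing sum Σ_k (-1)^k C(m+3,k) (k - 2) are -2, m + 3 and 0.
sumℤ-signed-[k+1]*[m+3]C[k+3]≡m+1 : ∀ m →
  sumℤ (suc m) (λ k → -1ℤ ℤ.^ k ℤ.* + (suc k * ((3 + m) C (3 + k)))) ≡ + suc m
sumℤ-signed-[k+1]*[m+3]C[k+3]≡m+1 m = begin
  T
    ≡⟨ isolate T (+ m) ⟩
  (+ 1 ℤ.+ + m) ℤ.- (ℤ.- + 2 ℤ.+ ((+ 3 ℤ.+ + m) ℤ.+ (0ℤ ℤ.+ -1ℤ ℤ.* T)))
    ≡⟨ cong (ℤ._-_ (+ 1 ℤ.+ + m)) (sym peel) ⟩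
  (+ 1 ℤ.+ + m) ℤ.- 0ℤ
    ≡⟨ ℤ.+-identityʳ _ ⟩
  + suc m ∎
  where
  N = 3 + m
  T = sumℤ (suc m) (λ k → -1ℤ ℤ.^ k ℤ.* + (suc k * (N C (3 + k))))
  g : ℕ → ℤ
  g k = + k ℤ.- + 2
  t : ℕ → ℤ
  t k = -1ℤ ℤ.^ k ℤ.* (+ (N C k) ℤ.* g k)
  isolate : ∀ T m → T ≡ (+ 1 ℤ.+ m) ℤ.- (ℤ.- + 2 ℤ.+ ((+ 3 ℤ.+ m) ℤ.+ (0ℤ ℤ.+ -1ℤ ℤ.* T)))
  isolate = ℤ-Solver.solve-∀
  vanishes : alternatingBinomialSum N g ≡ 0ℤ
  vanishes = trans (alternatingBinomialSum-distrib-+ N (+_) (const (ℤ.- + 2)))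
                   (cong₂ ℤ._+_ (alternatingBinomialSum-id (suc m)) (alternatingBinomialSum-const (suc (suc m)) (ℤ.- + 2)))
  t₁ : t 1 ≡ + 3 ℤ.+ + m
  t₁ rewrite nC1≡n N = simplify (+ N)
    where
    simplify : ∀ x → (-1ℤ ℤ.* + 1) ℤ.* (x ℤ.* (+ 1 ℤ.- + 2)) ≡ x
    simplify = ℤ-Solver.solve-∀
  t₂ : t 2 ≡ 0ℤ
  t₂ = trans (cong (-1ℤ ℤ.^ 2 ℤ.*_) (ℤ.*-zeroʳ (+ (N C 2)))) (ℤ.*-zeroʳ (-1ℤ ℤ.^ 2))
  t₃₊ : ∀ k → t (3 + k) ≡ -1ℤ ℤ.* (-1ℤ ℤ.^ k ℤ.* + (suc k * (N C (3 + k))))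
  t₃₊ k = trans (cong (λ z → -1ℤ ℤ.^ (3 + k) ℤ.* (+ c ℤ.* (z ℤ.- + 2))) (ℤ.pos-+ 3 k))
          (trans (simplify (-1ℤ ℤ.^ k) (+ c) (+ k)) (cong (λ z → -1ℤ ℤ.* (-1ℤ ℤ.^ k ℤ.* z)) (sym (ℤ.pos-* (suc k) c))))
    where
    c = N C (3 + k)
    simplify : ∀ s c x → (-1ℤ ℤ.* (-1ℤ ℤ.* (-1ℤ ℤ.* s))) ℤ.* (c ℤ.* ((+ 3 ℤ.+ x) ℤ.- + 2))
                       ≡ -1ℤ ℤ.* (s ℤ.* ((+ 1 ℤ.+ x) ℤ.* c))
    simplify = ℤ-Solver.solve-∀
  peel : 0ℤ ≡ ℤ.- + 2 ℤ.+ ((+ 3 ℤ.+ + m) ℤ.+ (0ℤ ℤ.+ -1ℤ ℤ.* T))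
  peel = begin
    0ℤ
      ≡⟨ sym vanishes ⟩
    sumℤ (suc N) t
      ≡⟨ sumℤ-suc-shift N t ⟩
    t 0 ℤ.+ sumℤ N (t ∘ suc)
      ≡⟨ cong (ℤ._+_ (t 0)) (sumℤ-suc-shift (2 + m) _) ⟩
    t 0 ℤ.+ (t 1 ℤ.+ sumℤ (2 + m) (λ k → t (2 + k)))
      ≡⟨ cong (λ z → t 0 ℤ.+ (t 1 ℤ.+ z)) (sumℤ-suc-shift (suc m) _) ⟩
    t 0 ℤ.+ (t 1 ℤ.+ (t 2 ℤ.+ sumℤ (suc m) (λ k → t (3 + k))))
      ≡⟨ cong₂ (λ x y → t 0 ℤ.+ (x ℤ.+ y)) t₁
           (cong₂ ℤ._+_ t₂ (trans (sumℤ-cong (suc m) t₃₊) (*-distribˡ-sumℤ (suc m) -1ℤ _))) ⟩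
    ℤ.- + 2 ℤ.+ ((+ 3 ℤ.+ + m) ℤ.+ (0ℤ ℤ.+ -1ℤ ℤ.* T)) ∎

-- Fractions and the right-hand side

toℚᵘ-/ : ∀ x d .{{_ : NonZero d}} → toℚᵘ (x / d) ≃ᵘ (x ℚᵘ./ d)
toℚᵘ-/ x (suc d) = ℚ.toℚᵘ-fromℚᵘ (mkℚᵘ x d)

/-≡-/ : ∀ x y a b .{{_ : NonZero a}} .{{_ : NonZero b}} → x ℤ.* + b ≡ y ℤ.* + a → x / a ≡ y / b
/-≡-/ x y a@(suc _) b@(suc _) eq =
  ℚ.toℚᵘ-injective (ℚᵘ.≃-trans (toℚᵘ-/ x a) (ℚᵘ.≃-trans (*≡* eq) (ℚᵘ.≃-sym (toℚᵘ-/ y b))))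

↥/-*-≡-*-↧/ : ∀ x d .{{_ : NonZero d}} → ↥ (x / d) ℤ.* + d ≡ x ℤ.* ↧ (x / d)
↥/-*-≡-*-↧/ x d@(suc _) = cross (x / d) (toℚᵘ-/ x d)
  where
  cross : ∀ q → toℚᵘ q ≃ᵘ (x ℚᵘ./ d) → ↥ q ℤ.* + d ≡ x ℤ.* ↧ q
  cross (ℚ.mkℚ _ _ _) eq = ℚᵘ.drop-*≡* eq

/-+-/ : ∀ x y d .{{_ : NonZero d}} → x / d ℚ.+ y / d ≡ (x ℤ.+ y) / d
/-+-/ x y d@(suc _) = ℚ.toℚᵘ-injective (≃.begin
  toℚᵘ (x / d ℚ.+ y / d)          ≃.≈⟨ ℚ.toℚᵘ-homo-+ (x / d) (y / d) ⟩
  toℚᵘ (x / d) ℚᵘ.+ toℚᵘ (y / d)   ≃.≈⟨ ℚᵘ.+-cong (toℚᵘ-/ x d) (toℚᵘ-/ y d) ⟩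
  x ℚᵘ./ d ℚᵘ.+ y ℚᵘ./ d          ≃.≈⟨ *≡* (collect x y (+ d)) ⟩
  (x ℤ.+ y) ℚᵘ./ d               ≃.≈⟨ ℚᵘ.≃-sym (toℚᵘ-/ (x ℤ.+ y) d) ⟩
  toℚᵘ ((x ℤ.+ y) / d)            ≃.∎)
  where
  module ≃ = ℚᵘ.≃-Reasoning
  collect : ∀ x y d → (x ℤ.* d ℤ.+ y ℤ.* d) ℤ.* d ≡ (x ℤ.+ y) ℤ.* (d ℤ.* d)
  collect = ℤ-Solver.solve-∀

/-−-/ : ∀ x y a b .{{_ : NonZero a}} .{{_ : NonZero b}} →
        x / a ℚ.- y / b ≡ ((x ℤ.* + b ℤ.- y ℤ.* + a) / (a * b)) {{m*n≢0 a b}}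
/-−-/ x y a@(suc _) b@(suc _) = ℚ.toℚᵘ-injective (≃.begin
  toℚᵘ (x / a ℚ.- y / b)
    ≃.≈⟨ ℚ.toℚᵘ-homo-+ (x / a) (ℚ.- (y / b)) ⟩
  toℚᵘ (x / a) ℚᵘ.+ toℚᵘ (ℚ.- (y / b))
    ≃.≈⟨ ℚᵘ.+-cong (toℚᵘ-/ x a) (ℚᵘ.≃-trans (ℚ.toℚᵘ-homo‿- (y / b)) (ℚᵘ.-‿cong (toℚᵘ-/ y b))) ⟩
  x ℚᵘ./ a ℚᵘ.- y ℚᵘ./ b
    ≃.≈⟨ *≡* (negate x y (+ a) (+ b)) ⟩
  (x ℤ.* + b ℤ.- y ℤ.* + a) ℚᵘ./ (a * b)
    ≃.≈⟨ ℚᵘ.≃-sym (toℚᵘ-/ _ (a * b)) ⟩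
  toℚᵘ ((x ℤ.* + b ℤ.- y ℤ.* + a) / (a * b)) ≃.∎)
  where
  module ≃ = ℚᵘ.≃-Reasoning
  negate : ∀ x y a b → (x ℤ.* b ℤ.+ ℤ.- y ℤ.* a) ℤ.* (a ℤ.* b) ≡ (x ℤ.* b ℤ.- y ℤ.* a) ℤ.* (a ℤ.* b)
  negate = ℤ-Solver.solve-∀

sumℚ1-/ : ∀ n (g : ℕ → ℚ) c d .{{_ : NonZero d}} →
          (∀ k → g (suc k) ≡ c k / d) → sumℚ1 n g ≡ sumℤ n c / d
sumℚ1-/ zero    g c d g≡c/d = sym (ℚ.0/n≡0 d)
sumℚ1-/ (suc n) g c d g≡c/d =
  trans (cong₂ ℚ._+_ (sumℚ1-/ n g c d g≡c/d) (g≡c/d n)) (/-+-/ (sumℤ n c) (c n) d)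

-1^[k+2]≡-1^k : ∀ k → -1ℤ ℤ.^ (suc k + 1) ≡ -1ℤ ℤ.^ k
-1^[k+2]≡-1^k zero    = refl
-1^[k+2]≡-1^k (suc k) = cong (-1ℤ ℤ.*_) (-1^[k+2]≡-1^k k)

rhsTerm-/ : ∀ n k → rhsTerm (suc n) (suc k)
                  ≡ (-1ℤ ℤ.^ k ℤ.* + (suc k * ((3 + n) C (3 + k)) * n !)) / ((2 + n) * (3 + n))
rhsTerm-/ n k = /-≡-/ (-1ℤ ℤ.^ (suc k + 1) ℤ.* + ((n C k) * suc n !)) (-1ℤ ℤ.^ k ℤ.* + (suc k * c * n !))
                      (2 + (3 * suc k + suc k * suc k)) ((2 + n) * (3 + n)) (begin
  -1ℤ ℤ.^ (suc k + 1) ℤ.* + ((n C k) * suc n !) ℤ.* + ((2 + n) * (3 + n))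
    ≡⟨ cong (λ s → s ℤ.* + ((n C k) * suc n !) ℤ.* + ((2 + n) * (3 + n))) (-1^[k+2]≡-1^k k) ⟩
  -1ℤ ℤ.^ k ℤ.* + ((n C k) * suc n !) ℤ.* + ((2 + n) * (3 + n))
    ≡⟨ signed-cong (-1ℤ ℤ.^ k) (begin
         (n C k) * suc n ! * ((2 + n) * (3 + n))
           ≡⟨ expandˡ n (n C k) (n !) ⟩
         n ! * (suc n * (2 + n) * (3 + n) * (n C k))
           ≡⟨ cong (n ! *_) (sym ([k+1][k+2][k+3]*[n+3]C[k+3]≡[n+1][n+2][n+3]*nCk n k)) ⟩
         n ! * (suc k * (2 + k) * (3 + k) * c)
           ≡⟨ expandʳ k c (n !) ⟩
         suc k * c * n ! * (2 + (3 * suc k + suc k * suc k)) ∎) ⟩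
  -1ℤ ℤ.^ k ℤ.* + (suc k * c * n !) ℤ.* + (2 + (3 * suc k + suc k * suc k)) ∎)
  where
  c = (3 + n) C (3 + k)
  expandˡ : ∀ n c f → c * (f + n * f) * ((2 + n) * (3 + n)) ≡ f * (suc n * (2 + n) * (3 + n) * c)
  expandˡ = ℕ-Solver.solve-∀
  expandʳ : ∀ k c f → f * (suc k * (2 + k) * (3 + k) * c) ≡ suc k * c * f * (2 + (3 * suc k + suc k * suc k))
  expandʳ = ℕ-Solver.solve-∀
  signed-cong : ∀ s {x y z w} → x * y ≡ z * w → s ℤ.* + x ℤ.* + y ≡ s ℤ.* + z ℤ.* + w
  signed-cong s {x} {y} {z} {w} eq = begin
    s ℤ.* + x ℤ.* + y   ≡⟨ ℤ.*-assoc s (+ x) (+ y) ⟩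
    s ℤ.* (+ x ℤ.* + y) ≡⟨ cong (s ℤ.*_) (sym (ℤ.pos-* x y)) ⟩
    s ℤ.* + (x * y)     ≡⟨ cong (λ t → s ℤ.* + t) eq ⟩
    s ℤ.* + (z * w)     ≡⟨ cong (s ℤ.*_) (ℤ.pos-* z w) ⟩
    s ℤ.* (+ z ℤ.* + w) ≡⟨ sym (ℤ.*-assoc s (+ z) (+ w)) ⟩
    s ℤ.* + z ℤ.* + w   ∎

rhs-closedForm : ∀ n → rhs (suc n) ≡ + (suc n !) / ((2 + n) * (3 + n))
rhs-closedForm n = begin
  rhs (suc n)                  ≡⟨ sumℚ1-/ (suc n) (rhsTerm (suc n)) _ D (rhsTerm-/ n) ⟩
  sumℤ (suc n) signedTerm / D  ≡⟨ cong (_/ D) sumℤ-signedTerm ⟩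
  + (suc n !) / D              ∎
  where
  D = (2 + n) * (3 + n)
  signedTerm : ℕ → ℤ
  signedTerm k = -1ℤ ℤ.^ k ℤ.* + (suc k * ((3 + n) C (3 + k)) * n !)
  factor : ∀ s a f → s ℤ.* + (a * f) ≡ + f ℤ.* (s ℤ.* + a)
  factor s a f = trans (cong (s ℤ.*_) (ℤ.pos-* a f)) (rotate s (+ a) (+ f))
    where
    rotate : ∀ s a f → s ℤ.* (a ℤ.* f) ≡ f ℤ.* (s ℤ.* a)
    rotate = ℤ-Solver.solve-∀
  sumℤ-signedTerm : sumℤ (suc n) signedTerm ≡ + (suc n !)
  sumℤ-signedTerm = begin
    sumℤ (suc n) signedTerm
      ≡⟨ sumℤ-cong (suc n) (λ k → factor (-1ℤ ℤ.^ k) (suc k * ((3 + n) C (3 + k))) (n !)) ⟩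
    sumℤ (suc n) (λ k → + (n !) ℤ.* (-1ℤ ℤ.^ k ℤ.* + (suc k * ((3 + n) C (3 + k)))))
      ≡⟨ *-distribˡ-sumℤ (suc n) (+ (n !)) _ ⟩
    + (n !) ℤ.* sumℤ (suc n) (λ k → -1ℤ ℤ.^ k ℤ.* + (suc k * ((3 + n) C (3 + k))))
      ≡⟨ cong (+ (n !) ℤ.*_) (sumℤ-signed-[k+1]*[m+3]C[k+3]≡m+1 n) ⟩
    + (n !) ℤ.* + suc n
      ≡⟨ sym (ℤ.pos-* (n !) (suc n)) ⟩
    + (n ! * suc n)
      ≡⟨ cong +_ (*-comm (n !) (suc n)) ⟩
    + (suc n !)
      ∎

riemannSum-error : ∀ n M .{{_ : NonZero M}} → ∃ λ w →
  (+ sumℕ M (λ x → x * rising x (suc n))) / M ℚ.- rhs (suc n) ≡ (+ M ℤ.* w) / ((2 + n) * (3 + n))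
riemannSum-error n M with ≈mod⇒≡+*ℤ {m = M * M} (sumℕ-x*rising-mod n M)
... | w , D*S≡M*f+M*M*w = w , (begin
  (+ S) / M ℚ.- rhs (suc n)                   ≡⟨ cong (ℚ._-_ ((+ S) / M)) (rhs-closedForm n) ⟩
  (+ S) / M ℚ.- (+ f) / D                     ≡⟨ /-−-/ (+ S) (+ f) M D ⟩
  ((+ S ℤ.* + D ℤ.- + f ℤ.* + M) / (M * D)) {{m*n≢0 M D}}
    ≡⟨ /-≡-/ (+ S ℤ.* + D ℤ.- + f ℤ.* + M) (+ M ℤ.* w) (M * D) D {{m*n≢0 M D}} (begin
         (+ S ℤ.* + D ℤ.- + f ℤ.* + M) ℤ.* + D
           ≡⟨ commute (+ S) (+ D) (+ f) (+ M) ⟩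
         (+ D ℤ.* + S ℤ.- + M ℤ.* + f) ℤ.* + D
           ≡⟨ cong (λ z → (z ℤ.- + M ℤ.* + f) ℤ.* + D) congruence ⟩
         (+ M ℤ.* + f ℤ.+ + M ℤ.* + M ℤ.* w ℤ.- + M ℤ.* + f) ℤ.* + D
           ≡⟨ cancel (+ M) (+ f) (+ D) w ⟩
         (+ M ℤ.* w) ℤ.* (+ M ℤ.* + D)
           ≡⟨ cong (ℤ._*_ (+ M ℤ.* w)) (sym (ℤ.pos-* M D)) ⟩
         (+ M ℤ.* w) ℤ.* + (M * D)                              ∎) ⟩
  (+ M ℤ.* w) / D                             ∎)
  where
  S = sumℕ M (λ x → x * rising x (suc n))
  f = suc n !
  D = (2 + n) * (3 + n)
  congruence : + D ℤ.* + S ≡ + M ℤ.* + f ℤ.+ + M ℤ.* + M ℤ.* w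
  congruence = begin
    + D ℤ.* + S                       ≡⟨ sym (ℤ.pos-* D S) ⟩
    + (D * S)                         ≡⟨ D*S≡M*f+M*M*w ⟩
    + (M * f) ℤ.+ + (M * M) ℤ.* w     ≡⟨ cong₂ (λ a b → a ℤ.+ b ℤ.* w) (ℤ.pos-* M f) (ℤ.pos-* M M) ⟩
    + M ℤ.* + f ℤ.+ + M ℤ.* + M ℤ.* w ∎
  commute : ∀ s d f m → (s ℤ.* d ℤ.- f ℤ.* m) ℤ.* d ≡ (d ℤ.* s ℤ.- m ℤ.* f) ℤ.* d
  commute = ℤ-Solver.solve-∀
  cancel : ∀ m f d w → (m ℤ.* f ℤ.+ m ℤ.* m ℤ.* w ℤ.- m ℤ.* f) ℤ.* d ≡ (m ℤ.* w) ℤ.* (m ℤ.* d)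
  cancel = ℤ-Solver.solve-∀

-- p-adic valuations

coprime-↥-↧ : (q : ℚ) → Coprime.Coprime ℤ.∣ ↥ q ∣ (↧ₙ q)
coprime-↥-↧ (ℚ.mkℚ _ _ coprime) = Coprime.recompute coprime

m^i∣m^j : ∀ m {i j} → i ≤ j → m ^ i ∣ m ^ j
m^i∣m^j m {i} {j} i≤j = divides (m ^ (j ∸ i)) (begin
  m ^ j                 ≡⟨ cong (m ^_) (sym (m+[n∸m]≡n i≤j)) ⟩
  m ^ (i + (j ∸ i))     ≡⟨ ^-distribˡ-+-* m i (j ∸ i) ⟩
  m ^ i * m ^ (j ∸ i)   ≡⟨ *-comm (m ^ i) (m ^ (j ∸ i)) ⟩
  m ^ (j ∸ i) * m ^ i   ∎)

module _ {p} (prime : Prime p) where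

  private instance
    p≢0 : NonZero p
    p≢0 = prime⇒nonZero prime

  p^e∣m*n∧p∤n⇒p^e∣m : ∀ {n} → ¬ p ∣ n → ∀ e m → p ^ e ∣ m * n → p ^ e ∣ m
  p^e∣m*n∧p∤n⇒p^e∣m p∤n zero    m _ = 1∣ m
  p^e∣m*n∧p∤n⇒p^e∣m {n} p∤n (suc e) m p^[1+e]∣mn with euclidsLemma m n prime (∣-trans (m∣m*n (p ^ e)) p^[1+e]∣mn)
  ... | inj₂ p∣n = contradiction p∣n p∤n
  ... | inj₁ (divides m′ refl) =
    subst (p * p ^ e ∣_) (*-comm p m′)
      (*-monoʳ-∣ p (p^e∣m*n∧p∤n⇒p^e∣m p∤n e m′ (*-cancelˡ-∣ p p[p^e]∣p[m′n])))
    where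
    p[p^e]∣p[m′n] : p * p ^ e ∣ p * (m′ * n)
    p[p^e]∣p[m′n] = subst (p * p ^ e ∣_) (trans (cong (_* n) (*-comm m′ p)) (*-assoc p m′ n)) p^[1+e]∣mn

  p-adicDecomposition : ∀ d .{{_ : NonZero d}} → ∃₂ λ u d′ → d ≡ p ^ u * d′ × ¬ p ∣ d′
  p-adicDecomposition d = <-rec P split d
    where
    P : ℕ → Set
    P d = .{{_ : NonZero d}} → ∃₂ λ u d′ → d ≡ p ^ u * d′ × ¬ p ∣ d′
    split : ∀ d → (∀ {e} → e < d → P e) → P d
    split d rec with p ∣? d
    ... | no p∤d = 0 , d , sym (+-identityʳ d) , p∤d
    ... | yes (divides q refl) with rec q<q*p {{q≢0}}
      where
      q≢0 : NonZero q
      q≢0 = ℕ.≢-nonZero λ { refl → ℕ.≢-nonZero⁻¹ (q * p) refl }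
      q<q*p : q < q * p
      q<q*p = m<m*n q p {{q≢0}} (ℕ.nonTrivial⇒n>1 p {{prime⇒nonTrivial prime}})
    ... | u , d′ , q≡ , p∤d′ = suc u , d′ , trans (cong (_* p) q≡) (rotate (p ^ u) d′ p) , p∤d′
      where
      rotate : ∀ a b c → a * b * c ≡ c * a * b
      rotate = ℕ-Solver.solve-∀

  valAtLeast-/ : ∀ x d .{{_ : NonZero d}} {u d′ e} → d ≡ p ^ u * d′ → ¬ p ∣ d′ → p ^ (e + u) ∣ ℤ.∣ x ∣ →
                 ValAtLeast p e (x / d)
  valAtLeast-/ x d {u} {d′} {e} refl p∤d′ (divides y ∣x∣≡y*p^[e+u]) = p∤↧q , p^e∣↥q
    where
    q = x / d
    instance
      p^u≢0 : NonZero (p ^ u)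
      p^u≢0 = m^n≢0 p u
    ↥q*d′≡p^e*y*↧q : ℤ.∣ ↥ q ∣ * d′ ≡ p ^ e * y * ↧ₙ q
    ↥q*d′≡p^e*y*↧q = *-cancelˡ-≡ _ _ (p ^ u) (begin
      p ^ u * (ℤ.∣ ↥ q ∣ * d′)       ≡⟨ swap (p ^ u) ℤ.∣ ↥ q ∣ d′ ⟩
      ℤ.∣ ↥ q ∣ * (p ^ u * d′)       ≡⟨ sym (ℤ.abs-* (↥ q) (+ d)) ⟩
      ℤ.∣ ↥ q ℤ.* + d ∣            ≡⟨ cong ℤ.∣_∣ (↥/-*-≡-*-↧/ x d) ⟩
      ℤ.∣ x ℤ.* ↧ q ∣              ≡⟨ ℤ.abs-* x (↧ q) ⟩
      ℤ.∣ x ∣ * ↧ₙ q                 ≡⟨ cong (λ z → z * ↧ₙ q) ∣x∣≡y*p^[e+u] ⟩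
      y * p ^ (e + u) * ↧ₙ q         ≡⟨ cong (λ z → y * z * ↧ₙ q) (^-distribˡ-+-* p e u) ⟩
      y * (p ^ e * p ^ u) * ↧ₙ q     ≡⟨ regroup y (p ^ e) (p ^ u) (↧ₙ q) ⟩
      p ^ u * (p ^ e * y * ↧ₙ q)     ∎)
      where
      swap : ∀ a b c → a * (b * c) ≡ b * (a * c)
      swap = ℕ-Solver.solve-∀
      regroup : ∀ y a b d → y * (a * b) * d ≡ b * (a * y * d)
      regroup = ℕ-Solver.solve-∀
    p^e∣↥q : p ^ e ∣ ℤ.∣ ↥ q ∣
    p^e∣↥q = p^e∣m*n∧p∤n⇒p^e∣m p∤d′ e ℤ.∣ ↥ q ∣
               (divides (y * ↧ₙ q) (trans ↥q*d′≡p^e*y*↧q (rotate (p ^ e) y (↧ₙ q))))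
      where
      rotate : ∀ a b c → a * b * c ≡ b * c * a
      rotate = ℕ-Solver.solve-∀
    ↧q∣d′ : ↧ₙ q ∣ d′
    ↧q∣d′ = coprime-divisor (Coprime.sym (coprime-↥-↧ q))
              (divides (p ^ e * y) ↥q*d′≡p^e*y*↧q)
    p∤↧q : ¬ p ∣ ↧ₙ q
    p∤↧q p∣↧q = p∤d′ (∣-trans p∣↧q ↧q∣d′)

mainTheorem4 : (p : ℕ) (pr : Prime p) (n : ℕ) → 1 ≤ n →
    VolkenbornIntegralEq p pr (λ x → x * rising x n) (rhs n)
mainTheorem4 p pr (suc n) _ e with p-adicDecomposition pr ((2 + n) * (3 + n))
... | u , d′ , D≡p^u*d′ , p∤d′ = e + u , λ N e+u≤N →
  let instance _ = m^n≢0 p N {{prime⇒nonZero pr}}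
      (w , error≡p^Nw/D) = riemannSum-error n (p ^ N)
      p^[e+u]∣p^Nw : p ^ (e + u) ∣ ℤ.∣ + p ^ N ℤ.* w ∣
      p^[e+u]∣p^Nw = subst (p ^ (e + u) ∣_) (sym (ℤ.abs-* (+ p ^ N) w))
                       (∣-trans (m^i∣m^j p e+u≤N) (m∣m*n ℤ.∣ w ∣))
  in subst (ValAtLeast p e) (sym error≡p^Nw/D)
       (valAtLeast-/ pr (+ p ^ N ℤ.* w) _ {u} {d′} {e} D≡p^u*d′ p∤d′ p^[e+u]∣p^Nw)
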